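{- Work constructively (intuitionistic logic with countable/dependent choice). $\mathrm{FAN}_{\Pi^0_1}$ implies the following statement (*): for every sequence of non-discontinuous functions $f_n : 2^{\mathbb{N}} \to \mathbb{R}$ and non-discontinuous $f : 2^{\mathbb{N}} \to \mathbb{R}$ such that $f_n \to f$ semi-uniformly at every point of $2^{\mathbb{N}}$, we have $f_n \to f$ uniformly on $2^{\mathbb{N}}$. Conversely, (*) implies UCT.
   Context: $2^{\mathbb{N}}$ is Cantor space with its usual metric; $2^*$ is the set of finite binary sequences and $\bar\alpha n$ is the initial segment of $\alpha$ of length $n$; $u * i$ denotes appending $i$ to $u$. A bar is a set $B \subseteq 2^*$ such that for every $\alpha \in 2^{\mathbb{N}}$ there is $n$ with $\bar\alpha n \in B$; it is uniform if there is $N$ such that for every $\alpha$ there is $n \leq N$ with $\bar\alpha n \in B$. $B$ is a $\Pi^0_1$-bar if there is a decidable $S \subseteq 2^* \times \mathbb{N}$ with $u \in B \iff \forall n\,(u,n) \in S$, and $(u,n) \in S \Rightarrow (u*0,n) \in S \wedge (u*1,n)\in S$. $\mathrm{FAN}_{\Pi^0_1}$: every $\Pi^0_1$-bar is uniform. UCT: every point-wise continuous function $2^{\mathbb{N}} \to \mathbb{R}$ is uniformly continuous. A function $g$ is non-discontinuous if there do not exist $x$, a sequence $x_n \to x$ and $\delta > 0$ with $\rho(g(x_n), g(x)) \geq \delta$ for all $n$. $(f_n)$ converges semi-uniformly at $x$ if for every $\varepsilon > 0$ there exist $N$ and $\delta > 0$ with $|f(y) - f_i(y)| < \varepsilon$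 for all $y$ with $\rho(x,y)<\delta$ and all $i \geq N$. Uniform convergence: for every $\varepsilon>0$ there is $N$ with $|f_n(\alpha)-f(\alpha)|<\varepsilon$ for all $n \ge N$ and all $\alpha$. -}

module Defs where

open import Data.Bool using (Bool)
open import Data.Nat as ℕ using (ℕ; suc)
open import Data.Integer using (+_)
open import Data.Rational using (ℚ; 0ℚ; _+_; _-_; ∣_∣; _<_; _≤_; _/_)
open import Data.List using (List; map; upTo; _∷ʳ_)
open import Data.Product using (Σ; _×_; ∃; ∃-syntax)
open import Data.Empty using (⊥)
open import Relation.Binary.PropositionalEquality using (_≡_)
open import Relation.Nullary using (¬_)

-- Bishop real numbers: regular sequences of rationals.
-- seq n approximates the real within 1/(n+1).

record ℝ : Set where
  field
    seq : ℕ → ℚ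
    reg : ∀ m n → ∣ seq m - seq n ∣ ≤ (+ 1 / suc m) + (+ 1 / suc n)
open ℝ public

_≃_ : ℝ → ℝ → Set
x ≃ y = ∀ n → ∣ seq x n - seq y n ∣ ≤ + 2 / suc n

-- The Bishop real |x - y|: its n-th term is |x_(2n+1) - y_(2n+1)|.
distSeq : ℝ → ℝ → ℕ → ℚ
distSeq x y n = ∣ seq x (suc (2 ℕ.* n)) - seq y (suc (2 ℕ.* n)) ∣

-- |x - y| < ε  (Bishop's strict order, ε a rational constant)
dist<_ : ℚ → ℝ → ℝ → Set
(dist< ε) x y = ∃[ n ] (distSeq x y n + (+ 2 / suc n) < ε)

-- |x - y| ≥ δ  (Bishop's non-strict order, δ a rational constant)
dist≥_ : ℚ → ℝ → ℝ → Set
(dist≥ δ) x y = ∀ n → δ ≤ distSeq x y n + (+ 2 / suc n)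

Cantor : Set
Cantor = ℕ → Bool

init : Cantor → ℕ → List Bool
init α n = map α (upTo n)

-- α and β agree on the first k bits (i.e. ρ(α,β) < 2^{-(k-1)});
-- the neighbourhoods "close k α" form a base at α for the usual metric.
close : ℕ → Cantor → Cantor → Set
close k α β = ∀ i → i ℕ.< k → α i ≡ β i

_⟶_ : (ℕ → Cantor) → Cantor → Set
xs ⟶ x = ∀ k → ∃[ M ] (∀ n → M ℕ.≤ n → close k (xs n) x)

Extensional : (Cantor → ℝ) → Set
Extensional g = ∀ α β → (∀ i → α i ≡ β i) → g α ≃ g β

NonDiscontinuous : (Cantor → ℝ) → Set
NonDiscontinuous g =
  ¬ (Σ Cantor λ x → Σ (ℕ → Cantor) λ xs → Σ ℚ λ δ →
       (0ℚ < δ) × (xs ⟶ x) × (∀ n → (dist≥ δ) (g (xs n)) (g x)))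

SemiUniformAt : (ℕ → Cantor → ℝ) → (Cantor → ℝ) → Cantor → Set
SemiUniformAt fs f x =
  ∀ ε → 0ℚ < ε → ∃[ N ] ∃[ k ] (∀ y → close k x y → ∀ i → N ℕ.≤ i →
     (dist< ε) (f y) (fs i y))

UniformConv : (ℕ → Cantor → ℝ) → (Cantor → ℝ) → Set
UniformConv fs f =
  ∀ ε → 0ℚ < ε → ∃[ N ] (∀ n → N ℕ.≤ n → ∀ α → (dist< ε) (fs n α) (f α))

PointwiseContinuous : (Cantor → ℝ) → Set
PointwiseContinuous g =
  ∀ α ε → 0ℚ < ε → ∃[ k ] (∀ β → close k α β → (dist< ε) (g α) (g β))

UniformlyContinuous : (Cantor → ℝ) → Set
UniformlyContinuous g =
  ∀ ε → 0ℚ < ε → ∃[ k ] (∀ α β → close k α β → (dist< ε) (g α) (g β))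

-- Π⁰₁-bars: given by a decidable S ⊆ 2* × ℕ (as a Bool-valued function),
-- closed under extension; u ∈ B ⇔ ∀ n, (u , n) ∈ S.
Mono : (List Bool → ℕ → Bool) → Set
Mono S = ∀ u n i → S u n ≡ Bool.true → S (u ∷ʳ i) n ≡ Bool.true
  where import Data.Bool as Bool

InB : (List Bool → ℕ → Bool) → List Bool → Set
InB S u = ∀ n → S u n ≡ Data.Bool.true
  where import Data.Bool

IsBar : (List Bool → Set) → Set
IsBar B = ∀ α → ∃[ n ] B (init α n)

IsUniformBar : (List Bool → Set) → Set
IsUniformBar B = ∃[ N ] (∀ α → ∃[ n ] (n ℕ.≤ N × B (init α n)))

FAN-Π⁰₁ : Set
FAN-Π⁰₁ = ∀ (S : List Bool → ℕ → Bool) → Mono S →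
  IsBar (InB S) → IsUniformBar (InB S)

UCT : Set
UCT = ∀ (g : Cantor → ℝ) → Extensional g → PointwiseContinuous g →
  UniformlyContinuous g

Star : Set
Star = ∀ (fs : ℕ → Cantor → ℝ) (f : Cantor → ℝ) →
  (∀ n → Extensional (fs n)) → Extensional f →
  (∀ n → NonDiscontinuous (fs n)) → NonDiscontinuous f →
  (∀ x → SemiUniformAt fs f x) →
  UniformConv fs f

-- FAN ⇒ (*): fix ε and c = 1/(k+1) with 4c < ε. The nodes u such that every point y extending u
-- satisfies |fᵢ y − f y| ≤ c for all i ≥ |u| form a Π⁰₁-set, and semi-uniform convergence makes it
-- a bar; FAN gives a uniform height N. So for i ≥ N and any α, fᵢ and f are c-close at the
-- truncations pₜ = ᾱ(N+t)0^ω → α. If |fᵢ α − f α| were ≥ ε, then at each pₜ either fᵢ stays c away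
-- from fᵢ α or f stays δ away from f α. If the second case occurs beyond every k, jumping to the first
-- such pₜ beyond k gives a sequence witnessing that f is discontinuous at α; otherwise the pₜ from
-- some point on witness that fᵢ is. Both contradict non-discontinuity, and the order on ℚ is decidable.
--
-- (*) ⇒ UCT: a pointwise continuous g is the semi-uniform limit of its truncations g(ᾱn0^ω), which
-- are continuous; uniform convergence of the truncations is uniform continuity of g.

module Submission where

open import Defs
open import Data.Bool using (Bool; true; false; if_then_else_)
open import Data.Empty using (⊥; ⊥-elim)
open import Data.Integer as ℤ using (+_)
open import Data.List as List using (List; []; _∷_; _++_; _∷ʳ_; length; applyUpTo; [_])
import Data.List.Properties as List
open import Data.Nat as ℕ using (ℕ; zero; suc; _∸_; z≤n; s≤s)
import Data.Nat.Properties as ℕ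
open import Data.Nat.Tactic.RingSolver using (solve-∀)
open import Data.Product using (∃-syntax; _×_; _,_; proj₁; proj₂)
open import Data.Sum as Sum using (_⊎_; inj₁; inj₂)
open import Data.Rational using (ℚ; 0ℚ; _+_; _-_; _*_; -_; ∣_∣; _<_; _≤_; _/_; toℚᵘ; mkℚ; *<*)
open import Data.Rational.Properties
open import Data.Rational.Solver using (module +-*-Solver)
import Data.Rational.Unnormalised as ℚᵘ
import Data.Rational.Unnormalised.Properties as ℚᵘ
open import Function using (_∘_)
open import Relation.Binary.PropositionalEquality using (_≡_; refl; sym; trans; cong; cong₂; subst; subst₂)
open import Relation.Nullary using (Dec; yes; no; does; ¬_; contradiction; map′; _×-dec_; _→-dec_)
open import Relation.Nullary.Decidable using (dec-true)

open +-*-Solver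

opaque
  1/suc : ℕ → ℚ
  1/suc n = + 1 / suc n

opaque
  unfolding 1/suc

  1/suc-def : ∀ n → 1/suc n ≡ + 1 / suc n
  1/suc-def n = refl

  2/suc≡1/suc+1/suc : ∀ n → + 2 / suc n ≡ 1/suc n + 1/suc n
  2/suc≡1/suc+1/suc n = toℚᵘ-injective (begin
      toℚᵘ (+ 2 / suc n)                            ≈⟨ toℚᵘ-fromℚᵘ (ℚᵘ.mkℚᵘ (+ 2) n) ⟩
      ℚᵘ.mkℚᵘ (+ 2) n                                ≈⟨ ℚᵘ.*≡* (cong +_ (lemma n)) ⟩
      ℚᵘ.mkℚᵘ (+ 1) n ℚᵘ.+ ℚᵘ.mkℚᵘ (+ 1) n          ≈⟨ ℚᵘ.≃-sym (ℚᵘ.+-cong (toℚᵘ-fromℚᵘ 1/[1+n]) (toℚᵘ-fromℚᵘ 1/[1+n])) ⟩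
      toℚᵘ (1/suc n) ℚᵘ.+ toℚᵘ (1/suc n)             ≈⟨ ℚᵘ.≃-sym (toℚᵘ-homo-+ (1/suc n) (1/suc n)) ⟩
      toℚᵘ (1/suc n + 1/suc n)                       ∎)
    where
    open ℚᵘ.≃-Reasoning
    1/[1+n] : ℚᵘ.ℚᵘ
    1/[1+n] = ℚᵘ.mkℚᵘ (+ 1) n
    lemma : ∀ n → suc (n ℕ.+ n ℕ.* suc n ℕ.+ 1 ℕ.* suc (n ℕ.+ n ℕ.* suc n))
                ≡ suc (n ℕ.+ (n ℕ.+ 0 ℕ.* suc n ℕ.+ suc (n ℕ.+ 0 ℕ.* suc n)) ℕ.* suc n)
    lemma = solve-∀

  1/suc-scale : ∀ K n → 1/suc (K ℕ.* suc n ℕ.+ n) * (+ suc K / 1) ≡ 1/suc n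
  1/suc-scale K n = toℚᵘ-injective (begin
      toℚᵘ (1/suc m * (+ suc K / 1))                            ≈⟨ toℚᵘ-homo-* (1/suc m) (+ suc K / 1) ⟩
      toℚᵘ (1/suc m) ℚᵘ.* toℚᵘ (+ suc K / 1)                    ≈⟨ ℚᵘ.*-cong (toℚᵘ-fromℚᵘ (ℚᵘ.mkℚᵘ (+ 1) m)) (toℚᵘ-fromℚᵘ (ℚᵘ.mkℚᵘ (+ suc K) 0)) ⟩
      ℚᵘ.mkℚᵘ (+ 1) m ℚᵘ.* ℚᵘ.mkℚᵘ (+ suc K) 0                  ≈⟨ ℚᵘ.*≡* (cong +_ (cong suc (lemma K n))) ⟩
      ℚᵘ.mkℚᵘ (+ 1) n                                           ≈⟨ ℚᵘ.≃-sym (toℚᵘ-fromℚᵘ (ℚᵘ.mkℚᵘ (+ 1) n)) ⟩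
      toℚᵘ (1/suc n)                                            ∎)
    where
    open ℚᵘ.≃-Reasoning
    m : ℕ
    m = K ℕ.* suc n ℕ.+ n
    lemma : ∀ K n → n ℕ.+ (K ℕ.+ 0 ℕ.* suc K) ℕ.* suc n
                  ≡ (K ℕ.* suc n ℕ.+ n) ℕ.* 1 ℕ.+ 0 ℕ.* suc ((K ℕ.* suc n ℕ.+ n) ℕ.* 1)
    lemma = solve-∀

  1/suc-pos : ∀ n → 0ℚ < 1/suc n
  1/suc-pos n = positive⁻¹ (1/suc n) {{normalize-pos 1 (suc n)}}

  archimedean : ∀ ε → 0ℚ < ε → ∃[ n ] 1/suc n < ε
  archimedean (mkℚ (+ zero) d _) (*<* (ℤ.+<+ ()))
  archimedean (mkℚ ℤ.-[1+ p ] d _) (*<* ())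
  archimedean (mkℚ (+ suc p) d _) _ = suc d , toℚᵘ-cancel-<
    (ℚᵘ.<-respˡ-≃ (ℚᵘ.≃-sym (toℚᵘ-fromℚᵘ (ℚᵘ.mkℚᵘ (+ 1) (suc d)))) (ℚᵘ.*<* (ℤ.+<+ (s≤s (s≤s (ℕ.+-monoʳ-≤ d z≤n))))))

odd : ℕ → ℕ
odd n = suc (2 ℕ.* n)

1/suc-nonneg : ∀ n → 0ℚ ≤ 1/suc n
1/suc-nonneg n = <⇒≤ (1/suc-pos n)

1/suc-half : ∀ n → 1/suc (odd n) + 1/suc (odd n) ≡ 1/suc n
1/suc-half n = begin
  1/suc (odd n) + 1/suc (odd n)          ≡⟨ solve 1 (λ x → x :+ x := x :* con (+ 2 / 1)) refl (1/suc (odd n)) ⟩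
  1/suc (odd n) * (+ 2 / 1)              ≡⟨ cong (λ k → 1/suc k * (+ 2 / 1)) (lemma n) ⟩
  1/suc (1 ℕ.* suc n ℕ.+ n) * (+ 2 / 1)  ≡⟨ 1/suc-scale 1 n ⟩
  1/suc n                                ∎
  where
  open Relation.Binary.PropositionalEquality.≡-Reasoning
  lemma : ∀ n → suc (2 ℕ.* n) ≡ 1 ℕ.* suc n ℕ.+ n
  lemma = solve-∀

archimedean-* : ∀ K ε → 0ℚ < ε → ∃[ n ] 1/suc n * (+ suc K / 1) < ε
archimedean-* K ε ε>0 with archimedean ε ε>0
... | n , 1/suc<ε = K ℕ.* suc n ℕ.+ n , subst (_< ε) (sym (1/suc-scale K n)) 1/suc<ε

≤-linear : ∀ {s₁ s₂ t₁ t₂} → s₁ ≤ s₂ → t₁ + s₂ ≡ t₂ + s₁ → t₁ ≤ t₂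
≤-linear {s₁} {s₂} {t₁} {t₂} s₁≤s₂ eq =
  subst₂ _≤_ (cancel t₁ s₁) (trans (cong (_- s₁) eq) (cancel t₂ s₁)) (+-monoˡ-≤ (- s₁) (+-monoʳ-≤ t₁ s₁≤s₂))
  where
  cancel : ∀ a b → a + b - b ≡ a
  cancel = solve 2 (λ a b → a :+ b :- b := a) refl

<-linear : ∀ {s₁ s₂ t₁ t₂} → s₁ < s₂ → t₁ + s₂ ≡ t₂ + s₁ → t₁ < t₂
<-linear {s₁} {s₂} {t₁} {t₂} s₁<s₂ eq =
  subst₂ _<_ (cancel t₁ s₁) (trans (cong (_- s₁) eq) (cancel t₂ s₁)) (+-monoˡ-< (- s₁) (+-monoʳ-< t₁ s₁<s₂))
  where
  cancel : ∀ a b → a + b - b ≡ a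
  cancel = solve 2 (λ a b → a :+ b :- b := a) refl

infixl 5 _⊕_ _⊕<_ _<⊕_

_⊕_ : ∀ {a b c d} → a ≤ b → c ≤ d → a + c ≤ b + d
_⊕_ = +-mono-≤

_⊕<_ : ∀ {a b c d} → a < b → c ≤ d → a + c < b + d
_⊕<_ = +-mono-<-≤

_<⊕_ : ∀ {a b c d} → a ≤ b → c < d → a + c < b + d
_<⊕_ = +-mono-≤-<

∣-∣-sym : ∀ a b → ∣ a - b ∣ ≡ ∣ b - a ∣
∣-∣-sym a b = trans (sym (∣-p∣≡∣p∣ (a - b))) (cong ∣_∣ (solve 2 (λ a b → :- (a :- b) := b :- a) refl a b))

∣-∣-triangle : ∀ a b c → ∣ a - c ∣ ≤ ∣ a - b ∣ + ∣ b - c ∣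
∣-∣-triangle a b c = subst (λ q → ∣ q ∣ ≤ ∣ a - b ∣ + ∣ b - c ∣)
  (solve 3 (λ a b c → (a :- b) :+ (b :- c) := a :- c) refl a b c) (∣p+q∣≤∣p∣+∣q∣ (a - b) (b - c))

2/suc-intro : ∀ {P : ℚ → Set} n → P (1/suc n + 1/suc n) → P (+ 2 / suc n)
2/suc-intro {P} n = subst P (sym (2/suc≡1/suc+1/suc n))

2/suc-elim : ∀ {P : ℚ → Set} n → P (+ 2 / suc n) → P (1/suc n + 1/suc n)
2/suc-elim {P} n = subst P (2/suc≡1/suc+1/suc n)

gap : ℝ → ℝ → ℕ → ℚ
gap x y j = ∣ seq x j - seq y j ∣

dist≤_ : ℚ → ℝ → ℝ → Set
(dist≤ c) x y = ∀ j → gap x y j ≤ c + (1/suc j + 1/suc j)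

gap-sym : ∀ x y j → gap x y j ≡ gap y x j
gap-sym x y j = ∣-∣-sym (seq x j) (seq y j)

gap-triangle : ∀ x y z j → gap x z j ≤ gap x y j + gap y z j
gap-triangle x y z j = ∣-∣-triangle (seq x j) (seq y j) (seq z j)

regular : ∀ x m n → ∣ seq x m - seq x n ∣ ≤ 1/suc m + 1/suc n
regular x m n = subst (∣ seq x m - seq x n ∣ ≤_) (sym (cong₂ _+_ (1/suc-def m) (1/suc-def n))) (reg x m n)

gap-shift : ∀ x y j k → gap x y j ≤ gap x y k + (1/suc j + 1/suc k) + (1/suc j + 1/suc k)
gap-shift x y j k = ≤-trans (∣-∣-triangle (seq x j) (seq x k) (seq y j))
  (≤-trans (+-monoʳ-≤ ∣xj-xk∣ (∣-∣-triangle (seq x k) (seq y k) (seq y j)))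
   (≤-linear (regular x j k ⊕ subst (_≤ 1/suc j + 1/suc k) (∣-∣-sym (seq y j) (seq y k)) (regular y j k))
     (solve 5 (λ a b c u v → (a :+ (b :+ c)) :+ ((u :+ v) :+ (u :+ v)) := (b :+ (u :+ v) :+ (u :+ v)) :+ (a :+ c)) refl
        ∣xj-xk∣ (gap x y k) (∣ seq y k - seq y j ∣) (1/suc j) (1/suc k))))
  where
  ∣xj-xk∣ : ℚ
  ∣xj-xk∣ = ∣ seq x j - seq x k ∣

dist<-sym : ∀ {ε x y} → (dist< ε) x y → (dist< ε) y x
dist<-sym {ε} {x} {y} (n , h) = n , subst (λ q → q + (+ 2 / suc n) < ε) (gap-sym x y (odd n)) h

dist<-weaken : ∀ {a b x y} → (dist< a) x y → a ≤ b → (dist< b) x y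
dist<-weaken (n , h) a≤b = n , <-≤-trans h a≤b

dist<⇒¬dist≥ : ∀ {δ x y} → (dist< δ) x y → ¬ (dist≥ δ) x y
dist<⇒¬dist≥ (n , h) g = <-irrefl refl (≤-<-trans (g n) h)

dist<⇒gap< : ∀ {a x y} → (w : (dist< a) x y) → ∀ j → gap x y j + 1/suc (proj₁ w) < a + (1/suc j + 1/suc j)
dist<⇒gap< {a} {x} {y} (n , h) j =
  arithmetic (gap x y j) (gap x y (odd n)) (1/suc n) (1/suc j) (1/suc (odd n)) a
    (gap-shift x y j (odd n)) (2/suc-elim {λ q → gap x y (odd n) + q < a} n h) (≤-reflexive (1/suc-half n))
  where
  arithmetic : ∀ g G e ε f a → g ≤ G + (ε + f) + (ε + f) → G + (e + e) < a → f + f ≤ e → g + e < a + (ε + ε)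
  arithmetic g G e ε f a h₁ h₂ h₃ = <-linear (h₁ <⊕ h₂ ⊕< h₃) (solve 6 (λ g G e ε f a →
     (g :+ e) :+ ((G :+ (ε :+ f) :+ (ε :+ f)) :+ a :+ e) := (a :+ (ε :+ ε)) :+ (g :+ (G :+ (e :+ e)) :+ (f :+ f))) refl g G e ε f a)

dist<⇒dist≤ : ∀ {a x y} → (dist< a) x y → (dist≤ a) x y
dist<⇒dist≤ {a} {x} {y} w j = arithmetic (gap x y j) (1/suc (proj₁ w)) a (1/suc j) (dist<⇒gap< {a} {x} {y} w j) (1/suc-nonneg (proj₁ w))
  where
  arithmetic : ∀ g e a ε → g + e < a + (ε + ε) → 0ℚ ≤ e → g ≤ a + (ε + ε)
  arithmetic g e a ε h₁ h₂ = ≤-linear (h₂ ⊕ <⇒≤ h₁) (solve 4 (λ g e a ε →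
     g :+ (e :+ (a :+ (ε :+ ε))) := (a :+ (ε :+ ε)) :+ (con 0ℚ :+ (g :+ e))) refl g e a ε)

gap⇒dist≥ : ∀ {r x y} j → r + (1/suc j + 1/suc j) ≤ gap x y j → (dist≥ r) x y
gap⇒dist≥ {r} {x} {y} j h n = 2/suc-intro {λ q → r ≤ gap x y (odd n) + q} n
  (arithmetic r (1/suc j) (gap x y j) (gap x y (odd n)) (1/suc (odd n)) (1/suc n) h (gap-shift x y j (odd n)) (≤-reflexive (1/suc-half n)) (1/suc-nonneg n))
  where
  arithmetic : ∀ r ε g G f e → r + (ε + ε) ≤ g → g ≤ G + (ε + f) + (ε + f) → f + f ≤ e → 0ℚ ≤ e → r ≤ G + (e + e)
  arithmetic r ε g G f e h₁ h₂ h₃ h₄ = ≤-linear (h₁ ⊕ h₂ ⊕ h₃ ⊕ h₄) (solve 6 (λ r ε g G f e →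
     r :+ (g :+ (G :+ (ε :+ f) :+ (ε :+ f)) :+ e :+ e) := (G :+ (e :+ e)) :+ ((r :+ (ε :+ ε)) :+ g :+ (f :+ f) :+ con 0ℚ)) refl r ε g G f e)

≃⇒dist< : ∀ {ε x y} → x ≃ y → 0ℚ < ε → (dist< ε) x y
≃⇒dist< {ε} {x} {y} x≃y ε>0 with archimedean-* 2 ε ε>0
... | n , 3/suc<ε = n , 2/suc-intro {λ q → gap x y (odd n) + q < ε} n
  (arithmetic (gap x y (odd n)) (1/suc (odd n)) (1/suc n) ε (2/suc-elim {λ q → gap x y (odd n) ≤ q} (odd n) (x≃y (odd n))) (≤-reflexive (1/suc-half n)) 3/suc<ε)
  where
  arithmetic : ∀ g f e ε → g ≤ f + f → f + f ≤ e → e * (+ 3 / 1) < ε → g + (e + e) < ε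
  arithmetic g f e ε h₁ h₂ h₃ = <-linear (h₁ ⊕ h₂ <⊕ h₃) (solve 4 (λ g f e ε →
     (g :+ (e :+ e)) :+ ((f :+ f) :+ e :+ ε) := ε :+ (g :+ (f :+ f) :+ e :* con (+ 3 / 1))) refl g f e ε)

dist<-trans : ∀ {a b x y z} → (dist< a) x y → (dist< b) y z → (dist< (a + b)) x z
dist<-trans {a} {b} {x} {y} {z} w₁ w₂ = n , 2/suc-intro {λ q → gap x z (odd n) + q < a + b} n
  (arithmetic (gap x y (odd n)) (1/suc n₁) a (1/suc (odd n)) (gap y z (odd n)) (1/suc (proj₁ w₂)) b (gap x z (odd n)) (1/suc n)
    (dist<⇒gap< {a} {x} {y} w₁ (odd n)) (dist<⇒gap< {b} {y} {z} w₂ (odd n)) (gap-triangle x y z (odd n))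
    (≤-reflexive (1/suc-half n)) (≤-reflexive (1/suc-scale 3 n₁)) (1/suc-nonneg (proj₁ w₂)))
  where
  n₁ n : ℕ
  n₁ = proj₁ w₁
  n = 3 ℕ.* suc n₁ ℕ.+ n₁
  arithmetic : ∀ g₁ e₁ a f g₂ e₂ b g e → g₁ + e₁ < a + (f + f) → g₂ + e₂ < b + (f + f) → g ≤ g₁ + g₂ →
               f + f ≤ e → e * (+ 4 / 1) ≤ e₁ → 0ℚ ≤ e₂ → g + (e + e) < a + b
  arithmetic g₁ e₁ a f g₂ e₂ b g e h₁ h₂ h₃ h₄ h₅ h₆ = <-linear (h₁ ⊕< h₃ ⊕< h₄ ⊕< h₄ ⊕< h₅ ⊕< h₆ ⊕< <⇒≤ h₂)
    (solve 9 (λ g₁ e₁ a f g₂ e₂ b g e →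
       (g :+ (e :+ e)) :+ ((a :+ (f :+ f)) :+ (g₁ :+ g₂) :+ e :+ e :+ e₁ :+ e₂ :+ (b :+ (f :+ f)))
       := (a :+ b) :+ ((g₁ :+ e₁) :+ g :+ (f :+ f) :+ (f :+ f) :+ e :* con (+ 4 / 1) :+ con 0ℚ :+ (g₂ :+ e₂)))
     refl g₁ e₁ a f g₂ e₂ b g e)

dist≥-respˡ-≃ : ∀ {r x x′ y} → x ≃ x′ → (dist≥ r) x y → (dist≥ r) x′ y
dist≥-respˡ-≃ {r} {x} {x′} {y} x≃x′ x-far n = 2/suc-intro {λ q → r ≤ gap x′ y (odd n) + q} n
  (arithmetic r (gap x y M) (1/suc m) (gap x x′ M) (1/suc M) (gap x′ y M) (gap x′ y (odd n)) (1/suc (odd n)) (1/suc n)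
    (2/suc-elim {λ q → r ≤ gap x y M + q} m (x-far m)) (2/suc-elim {λ q → gap x x′ M ≤ q} M (x≃x′ M))
    (gap-triangle x x′ y M) (gap-shift x′ y M (odd n))
    (≤-reflexive (1/suc-half m)) (≤-reflexive (1/suc-half n)) (≤-reflexive (1/suc-scale 3 n)))
  where
  m M : ℕ
  m = 3 ℕ.* suc n ℕ.+ n
  M = odd m
  arithmetic : ∀ r g e d f g′ G′ f′ e′ → r ≤ g + (e + e) → d ≤ f + f → g ≤ d + g′ →
               g′ ≤ G′ + (f + f′) + (f + f′) → f + f ≤ e → f′ + f′ ≤ e′ → e * (+ 4 / 1) ≤ e′ → r ≤ G′ + (e′ + e′)
  arithmetic r g e d f g′ G′ f′ e′ h₁ h₂ h₃ h₄ h₅ h₆ h₇ = ≤-linear (h₁ ⊕ h₂ ⊕ h₃ ⊕ h₄ ⊕ h₅ ⊕ h₅ ⊕ h₆ ⊕ h₇)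
    (solve 9 (λ r g e d f g′ G′ f′ e′ →
       r :+ ((g :+ (e :+ e)) :+ (f :+ f) :+ (d :+ g′) :+ (G′ :+ (f :+ f′) :+ (f :+ f′)) :+ e :+ e :+ e′ :+ e′)
       := (G′ :+ (e′ :+ e′)) :+ (r :+ d :+ g :+ g′ :+ (f :+ f) :+ (f :+ f) :+ (f′ :+ f′) :+ e :* con (+ 4 / 1)))
     refl r g e d f g′ G′ f′ e′)

extendFalse : List Bool → Cantor
extendFalse []      _       = false
extendFalse (b ∷ _) zero    = b
extendFalse (_ ∷ u) (suc j) = extendFalse u j

extendFalse-++ : ∀ u w {j} → j ℕ.< length u → extendFalse (u ++ w) j ≡ extendFalse u j
extendFalse-++ (_ ∷ _) w {zero}  _         = refl
extendFalse-++ (_ ∷ u) w {suc j} (s≤s j<∣u∣) = extendFalse-++ u w j<∣u∣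

extendFalse-beyond : ∀ u {j} → length u ℕ.≤ j → extendFalse u j ≡ false
extendFalse-beyond []      _           = refl
extendFalse-beyond (_ ∷ u) (s≤s ∣u∣≤j) = extendFalse-beyond u ∣u∣≤j

extendFalse-applyUpTo : ∀ (h : ℕ → Bool) n {j} → j ℕ.< n → extendFalse (applyUpTo h n) j ≡ h j
extendFalse-applyUpTo h (suc n) {zero}  _       = refl
extendFalse-applyUpTo h (suc n) {suc j} (s≤s j<n) = extendFalse-applyUpTo (h ∘ suc) n j<n

length-init : ∀ α n → length (init α n) ≡ n
length-init α n = trans (cong length (List.map-upTo α n)) (List.length-applyUpTo α n)

extendFalse-init : ∀ α n {j} → j ℕ.< n → extendFalse (init α n) j ≡ α j
extendFalse-init α n j<n = trans (cong (λ v → extendFalse v _) (List.map-upTo α n)) (extendFalse-applyUpTo α n j<n)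

init-prefix : ∀ α {m M} → m ℕ.≤ M → ∃[ w ] init α m ++ w ≡ init α M
init-prefix α {m} {M} m≤M = w , (begin
  init α m ++ w               ≡⟨ cong (_++ w) (List.map-upTo α m) ⟩
  applyUpTo α m ++ w          ≡⟨ applyUpTo-++ α m (M ∸ m) ⟨
  applyUpTo α (m ℕ.+ (M ∸ m)) ≡⟨ cong (applyUpTo α) (ℕ.m+[n∸m]≡n m≤M) ⟩
  applyUpTo α M               ≡⟨ List.map-upTo α M ⟨
  init α M                    ∎)
  where
  open Relation.Binary.PropositionalEquality.≡-Reasoning
  w : List Bool
  w = applyUpTo (λ i → α (m ℕ.+ i)) (M ∸ m)
  applyUpTo-++ : ∀ (h : ℕ → Bool) a b → applyUpTo h (a ℕ.+ b) ≡ applyUpTo h a ++ applyUpTo (λ i → h (a ℕ.+ i)) b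
  applyUpTo-++ h zero    b = refl
  applyUpTo-++ h (suc a) b = cong (h 0 ∷_) (applyUpTo-++ (h ∘ suc) a b)

pad : ℕ → Cantor → Cantor
pad n α = extendFalse (init α n)

pad-close : ∀ n α → close n (pad n α) α
pad-close n α i i<n = extendFalse-init α n i<n

pad-cong : ∀ n α β → close n α β → ∀ j → pad n α j ≡ pad n β j
pad-cong n α β α≈β j with j ℕ.<? n
... | yes j<n = trans (extendFalse-init α n j<n) (trans (α≈β j j<n) (sym (extendFalse-init β n j<n)))
... | no  j≮n = trans (beyond α) (sym (beyond β))
  where
  beyond : ∀ γ → pad n γ j ≡ false
  beyond γ = extendFalse-beyond (init γ n) (subst (ℕ._≤ j) (sym (length-init γ n)) (ℕ.≮⇒≥ j≮n))

close-mono : ∀ {k k′ α β} → k ℕ.≤ k′ → close k′ α β → close k α β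
close-mono k≤k′ α≈β i i<k = α≈β i (ℕ.<-≤-trans i<k k≤k′)

close⇒⟶ : ∀ {xs x} → (∀ t → close t (xs t) x) → xs ⟶ x
close⇒⟶ xs≈x k = k , λ t k≤t → close-mono k≤t (xs≈x t)

dec-true⁻¹ : ∀ {A : Set} (a? : Dec A) → does a? ≡ true → A
dec-true⁻¹ (yes a) _ = a

dec-false⁻¹ : ∀ {A : Set} (a? : Dec A) → does a? ≡ false → ¬ A
dec-false⁻¹ (no ¬a) _ = ¬a

AllExtensions : (List Bool → Set) → ℕ → List Bool → Set
AllExtensions P k u = ∀ w → length w ℕ.≤ k → P (u ++ w)

allExtensions? : ∀ {P : List Bool → Set} → (∀ v → Dec (P v)) → ∀ k u → Dec (AllExtensions P k u)
allExtensions? {P} P? zero u = map′ to from (P? u)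
  where
  to : P u → AllExtensions P zero u
  to Pu [] _ = subst P (sym (List.++-identityʳ u)) Pu
  from : AllExtensions P zero u → P u
  from all = subst P (List.++-identityʳ u) (all [] z≤n)
allExtensions? {P} P? (suc k) u =
  map′ to from (P? u ×-dec allExtensions? P? k (u ∷ʳ false) ×-dec allExtensions? P? k (u ∷ʳ true))
  where
  branch : ∀ b → AllExtensions P k (u ∷ʳ b) → ∀ w → length w ℕ.≤ k → P (u ++ b ∷ w)
  branch b all w ∣w∣≤k = subst P (List.++-assoc u [ b ] w) (all w ∣w∣≤k)
  to : P u × AllExtensions P k (u ∷ʳ false) × AllExtensions P k (u ∷ʳ true) → AllExtensions P (suc k) u
  to (Pu , _ , _)   []          _             = subst P (sym (List.++-identityʳ u)) Pu
  to (_ , all₀ , _) (false ∷ w) (s≤s ∣w∣≤k) = branch false all₀ w ∣w∣≤k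
  to (_ , _ , all₁) (true ∷ w)  (s≤s ∣w∣≤k) = branch true all₁ w ∣w∣≤k
  from : AllExtensions P (suc k) u → P u × AllExtensions P k (u ∷ʳ false) × AllExtensions P k (u ∷ʳ true)
  from all = subst P (List.++-identityʳ u) (all [] z≤n) , unbranch false , unbranch true
    where
    unbranch : ∀ b → AllExtensions P k (u ∷ʳ b)
    unbranch b w ∣w∣≤k = subst P (sym (List.++-assoc u [ b ] w)) (all (b ∷ w) (s≤s ∣w∣≤k))

Secured : (List Bool → ℕ → ℕ → Set) → List Bool → Set
Secured R u = ∀ w i j → length u ℕ.≤ i → R (u ++ w) i j

CheckedUpTo : (List Bool → ℕ → ℕ → Set) → ℕ → ℕ → List Bool → Set
CheckedUpTo R L n v = ∀ {i} → i ℕ.< suc n → L ℕ.≤ i → ∀ {j} → j ℕ.< suc n → R v i j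

module _ {R : List Bool → ℕ → ℕ → Set} (R? : ∀ v i j → Dec (R v i j)) where

  checkedUpTo? : ∀ L n v → Dec (CheckedUpTo R L n v)
  checkedUpTo? L n v = ℕ.allUpTo? (λ i → (L ℕ.≤? i) →-dec ℕ.allUpTo? (R? v i) (suc n)) (suc n)

  -- Bounding extensions by n ∸ length u and indices by n makes each stage finite and the
  -- sequence monotone under extension.
  securedSeq? : ∀ u n → Dec (AllExtensions (CheckedUpTo R (length u) n) (n ∸ length u) u)
  securedSeq? u n = allExtensions? (checkedUpTo? (length u) n) (n ∸ length u) u

  securedSeq : List Bool → ℕ → Bool
  securedSeq u n = does (securedSeq? u n)

  securedSeq-mono : Mono securedSeq
  securedSeq-mono u n b h = dec-true (securedSeq? (u ∷ʳ b) n) (extend (dec-true⁻¹ (securedSeq? u n) h))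
    where
    L : ℕ
    L = length u
    ∣u∷ʳb∣ : length (u ∷ʳ b) ≡ suc L
    ∣u∷ʳb∣ = trans (List.length-++ u) (ℕ.+-comm L 1)
    extend : AllExtensions (CheckedUpTo R L n) (n ∸ L) u →
             AllExtensions (CheckedUpTo R (length (u ∷ʳ b)) n) (n ∸ length (u ∷ʳ b)) (u ∷ʳ b)
    extend all w ∣w∣≤ {i} i<1+n 1+L≤i {j} j<1+n =
      subst (λ v → R v i j) (sym (List.++-assoc u [ b ] w)) (all (b ∷ w) ∣b∷w∣≤ i<1+n (ℕ.<⇒≤ L<i) j<1+n)
      where
      L<i : L ℕ.< i
      L<i = subst (ℕ._≤ i) ∣u∷ʳb∣ 1+L≤i
      ∣b∷w∣≤ : suc (length w) ℕ.≤ n ∸ L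
      ∣b∷w∣≤ = subst (suc (length w) ℕ.≤_) (sym (ℕ.+-∸-assoc 1 (ℕ.≤-trans L<i (ℕ.s≤s⁻¹ i<1+n))))
                 (s≤s (subst (λ m → length w ℕ.≤ n ∸ m) ∣u∷ʳb∣ ∣w∣≤))

  InB⇒Secured : ∀ u → InB securedSeq u → Secured R u
  InB⇒Secured u inb w i j L≤i =
    dec-true⁻¹ (securedSeq? u n) (inb n) w ∣w∣≤ (s≤s (bounded i (ℕ.m≤m+n i j))) L≤i (s≤s (bounded j (ℕ.m≤n+m j i)))
    where
    L n : ℕ
    L = length u
    n = L ℕ.+ (length w ℕ.+ (i ℕ.+ j))
    ∣w∣≤ : length w ℕ.≤ n ∸ L
    ∣w∣≤ = subst (length w ℕ.≤_) (sym (ℕ.m+n∸m≡n L _)) (ℕ.m≤m+n _ _)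
    bounded : ∀ k → k ℕ.≤ i ℕ.+ j → k ℕ.≤ n
    bounded k k≤i+j = ℕ.≤-trans k≤i+j (ℕ.≤-trans (ℕ.m≤n+m _ (length w)) (ℕ.m≤n+m _ L))

  Secured⇒InB : ∀ u → Secured R u → InB securedSeq u
  Secured⇒InB u sec n = dec-true (securedSeq? u n) (λ w _ _ L≤i _ → sec w _ _ L≤i)

module FirstHit (lab : ℕ → Bool) where

  FirstHitFrom : ℕ → ℕ → Set
  FirstHitFrom k m = k ℕ.≤ m × lab m ≡ true × (∀ {m′} → k ℕ.≤ m′ → m′ ℕ.< m → lab m′ ≡ false)

  noFirstHit⇒allFalse : ∀ {k} → (∀ m → ¬ FirstHitFrom k m) → ∀ {m} → k ℕ.≤ m → lab m ≡ false
  noFirstHit⇒allFalse {k} noHit {m} k≤m = below (suc m) k≤m (ℕ.≤-trans (ℕ.n<1+n m) (ℕ.m≤n+m (suc m) k))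
    where
    below : ∀ d {m} → k ℕ.≤ m → m ℕ.< k ℕ.+ d → lab m ≡ false
    below zero    k≤m m<k+0 = contradiction (subst (_ ℕ.<_) (ℕ.+-identityʳ k) m<k+0) (ℕ.≤⇒≯ k≤m)
    below (suc d) {m} k≤m m<k+1+d with m ℕ.<? k ℕ.+ d
    ... | yes m<k+d = below d k≤m m<k+d
    ... | no  _ with lab m in eq
    ...   | false = refl
    ...   | true  = ⊥-elim (noHit m (k≤m , eq , λ k≤m′ m′<m → below d k≤m′ (ℕ.<-≤-trans m′<m m≤k+d)))
      where
      m≤k+d : m ℕ.≤ k ℕ.+ d
      m≤k+d = ℕ.s≤s⁻¹ (subst (m ℕ.<_) (ℕ.+-suc k d) m<k+1+d)

  module _ (p : ℕ → Cantor) (α : Cantor) (p-close : ∀ m → close m (p m) α) where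

    -- Only the labels k … k + j are searched: a first hit m beyond k + j has p m j ≡ α j anyway.
    search : ℕ → ℕ → ℕ → Bool
    search k zero    j = α j
    search k (suc f) j = if lab k then p k j else search (suc k) f j

    firstHit : ℕ → Cantor
    firstHit k j = search k (suc j) j

    search-close : ∀ k f {j} → j ℕ.< k → search k f j ≡ α j
    search-close k zero    j<k = refl
    search-close k (suc f) j<k with lab k
    ... | true  = p-close k _ j<k
    ... | false = search-close (suc k) f (ℕ.m<n⇒m<1+n j<k)

    firstHit-close : ∀ k → close k (firstHit k) α
    firstHit-close k j j<k = search-close k (suc j) j<k

    search-hit : ∀ {m k} → FirstHitFrom k m → ∀ f {j} → j ℕ.< m ⊎ m ℕ.< k ℕ.+ f → search k f j ≡ p m j
    search-hit (k≤m , _ , _) zero (inj₁ j<m) = sym (p-close _ _ j<m)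
    search-hit (k≤m , _ , _) zero (inj₂ m<k+0) = contradiction (subst (_ ℕ.<_) (ℕ.+-identityʳ _) m<k+0) (ℕ.≤⇒≯ k≤m)
    search-hit {m} {k} (k≤m , hit , before) (suc f) j<m⊎m<k+1+f with lab k in eq
    ... | true  = cong (λ k → p k _) (ℕ.≤-antisym k≤m (ℕ.≮⇒≥ λ k<m → contradiction (trans (sym eq) (before ℕ.≤-refl k<m)) λ ()))
    ... | false = search-hit (k<m , hit , λ k<m′ → before (ℕ.<⇒≤ k<m′)) f
                    (Sum.map₂ (subst (m ℕ.<_) (ℕ.+-suc k f)) j<m⊎m<k+1+f)
      where
      k<m : k ℕ.< m
      k<m = ℕ.≤∧≢⇒< k≤m λ { refl → contradiction (trans (sym eq) hit) λ () }

    firstHit-hit : ∀ {m k} → FirstHitFrom k m → ∀ j → firstHit k j ≡ p m j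
    firstHit-hit {m} {k} h j with j ℕ.<? m
    ... | yes j<m = search-hit h (suc j) (inj₁ j<m)
    ... | no  j≮m = search-hit h (suc j) (inj₂ (ℕ.≤-<-trans (ℕ.≮⇒≥ j≮m) (ℕ.m≤n+m (suc j) k)))

module NearOnApproximants
  (g f : Cantor → ℝ) (f-ext : Extensional f)
  (g-nd : NonDiscontinuous g) (f-nd : NonDiscontinuous f)
  (α : Cantor) (p : ℕ → Cantor) (p-close : ∀ t → close t (p t) α)
  (c : ℚ) (c>0 : 0ℚ < c) (near : ∀ t → (dist≤ c) (g (p t)) (f (p t)))
  where

  module _ (ε : ℚ) (n : ℕ) (4c<ε : c * (+ 4 / 1) < ε) (10/suc<ε : 1/suc n * (+ 10 / 1) < ε)
           (far : ε ≤ distSeq (g α) (f α) n + (+ 2 / suc n)) where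

    J : ℕ
    J = odd n

    δ : ℚ
    δ = ε - (c + c) - 1/suc n * (+ 5 / 1)

    δ>0 : 0ℚ < δ
    δ>0 = half>0 (<-linear (+-mono-< 4c<ε 10/suc<ε) (solve 3 (λ c e ε →
      con 0ℚ :+ (ε :+ ε) := (d c e ε :+ d c e ε) :+ (c :* con (+ 4 / 1) :+ e :* con (+ 10 / 1))) refl c (1/suc n) ε))
      where
      d : ∀ {k} → Polynomial k → Polynomial k → Polynomial k → Polynomial k
      d c e ε = ε :- (c :+ c) :- e :* con (+ 5 / 1)
      half>0 : 0ℚ < δ + δ → 0ℚ < δ
      half>0 2δ>0 with δ ≤? 0ℚ
      ... | no  δ≰0 = ≰⇒> δ≰0
      ... | yes δ≤0 = contradiction (≤-<-trans (+-mono-≤ δ≤0 δ≤0) 2δ>0) (<-irrefl refl)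

    -- "g (p t) is c-close to g α", made decidable by testing only at the index J of `far`.
    gNear? : ∀ t → Dec (gap (g (p t)) (g α) J < c + (1/suc J + 1/suc J))
    gNear? t = gap (g (p t)) (g α) J <? c + (1/suc J + 1/suc J)

    gNear : ℕ → Bool
    gNear t = does (gNear? t)

    gNear-false⇒g-far : ∀ t → gNear t ≡ false → (dist≥ c) (g (p t)) (g α)
    gNear-false⇒g-far t h = gap⇒dist≥ {c} {g (p t)} {g α} J (≮⇒≥ (dec-false⁻¹ (gNear? t) h))

    gNear-true⇒f-far : ∀ t → gNear t ≡ true → (dist≥ δ) (f (p t)) (f α)
    gNear-true⇒f-far t h = gap⇒dist≥ {δ} {b} {B} J (arithmetic ε (gap A B J) (1/suc n) (gap a A J) c (1/suc J) (gap a b J) (gap b B J)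
      (2/suc-elim {λ q → ε ≤ gap A B J + q} n far) (<⇒≤ (dec-true⁻¹ (gNear? t) h)) (near t J) triangle (≤-reflexive (1/suc-half n)))
      where
      a b A B : ℝ
      a = g (p t)
      b = f (p t)
      A = g α
      B = f α
      triangle : gap A B J ≤ gap a A J + gap a b J + gap b B J
      triangle = begin
        gap A B J                         ≤⟨ gap-triangle A a B J ⟩
        gap A a J + gap a B J             ≤⟨ +-monoʳ-≤ (gap A a J) (gap-triangle a b B J) ⟩
        gap A a J + (gap a b J + gap b B J) ≡⟨ +-assoc (gap A a J) (gap a b J) (gap b B J) ⟨
        gap A a J + gap a b J + gap b B J ≡⟨ cong (λ q → q + gap a b J + gap b B J) (gap-sym A a J) ⟩
        gap a A J + gap a b J + gap b B J ∎
        where open ≤-Reasoning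
      arithmetic : ∀ ε G e ga c f gab gb → ε ≤ G + (e + e) → ga ≤ c + (f + f) → gab ≤ c + (f + f) →
                   G ≤ ga + gab + gb → f + f ≤ e → (ε - (c + c) - e * (+ 5 / 1)) + (f + f) ≤ gb
      arithmetic ε G e ga c f gab gb h₁ h₂ h₃ h₄ h₅ = ≤-linear (h₁ ⊕ h₂ ⊕ h₃ ⊕ h₄ ⊕ h₅ ⊕ h₅ ⊕ h₅)
        (solve 8 (λ ε G e ga c f gab gb →
           ((ε :- (c :+ c) :- e :* con (+ 5 / 1)) :+ (f :+ f))
             :+ ((G :+ (e :+ e)) :+ (c :+ (f :+ f)) :+ (c :+ (f :+ f)) :+ (ga :+ gab :+ gb) :+ e :+ e :+ e)
           := gb :+ (ε :+ ga :+ gab :+ G :+ (f :+ f) :+ (f :+ f) :+ (f :+ f)))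
         refl ε G e ga c f gab gb)

    open FirstHit gNear

    z : ℕ → Cantor
    z = firstHit p α p-close

    -- Were f (z k) not δ-far from f α, no t ≥ k would have gNear t, so g would jump at α.
    f-far-along-z : ∀ k → (dist≥ δ) (f (z k)) (f α)
    f-far-along-z k i with δ ≤? distSeq (f (z k)) (f α) i + (+ 2 / suc i)
    ... | yes δ≤ = δ≤
    ... | no  δ≰ = ⊥-elim (g-nd (α , p ∘ (k ℕ.+_) , c , c>0 , close⇒⟶ shifted-close , g-far))
      where
      no-hit : ∀ m → ¬ FirstHitFrom k m
      no-hit m hit@(_ , near-m , _) = δ≰ (dist≥-respˡ-≃ {δ} {f (p m)} {f (z k)} {f α}
        (f-ext (p m) (z k) (λ j → sym (firstHit-hit p α p-close hit j))) (gNear-true⇒f-far m near-m) i)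
      shifted-close : ∀ t → close t (p (k ℕ.+ t)) α
      shifted-close t = close-mono (ℕ.m≤n+m t k) (p-close (k ℕ.+ t))
      g-far : ∀ t → (dist≥ c) (g (p (k ℕ.+ t))) (g α)
      g-far t = gNear-false⇒g-far (k ℕ.+ t) (noFirstHit⇒allFalse no-hit (ℕ.m≤m+n k t))

    absurd : ⊥
    absurd = f-nd (α , z , δ , δ>0 , close⇒⟶ (firstHit-close p α p-close) , f-far-along-z)

  dist<-at-limit : ∀ ε → c * (+ 4 / 1) < ε → (dist< ε) (g α) (f α)
  dist<-at-limit ε 4c<ε = decide (distSeq (g α) (f α) n + (+ 2 / suc n) <? ε)
    where
    ε>0 : 0ℚ < ε
    ε>0 = <-trans (<-linear (c>0 ⊕< <⇒≤ c>0 ⊕< <⇒≤ c>0 ⊕< <⇒≤ c>0)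
            (solve 1 (λ c → con 0ℚ :+ (c :+ c :+ c :+ c) := c :* con (+ 4 / 1) :+ (con 0ℚ :+ con 0ℚ :+ con 0ℚ :+ con 0ℚ)) refl c)) 4c<ε
    n : ℕ
    n = proj₁ (archimedean-* 9 ε ε>0)
    decide : Dec (distSeq (g α) (f α) n + (+ 2 / suc n) < ε) → (dist< ε) (g α) (f α)
    decide (yes close-at-n) = n , close-at-n
    decide (no  far)        = ⊥-elim (absurd ε n 4c<ε (proj₂ (archimedean-* 9 ε ε>0)) (≮⇒≥ far))

WithinAt : (ℕ → Cantor → ℝ) → (Cantor → ℝ) → ℚ → List Bool → ℕ → ℕ → Set
WithinAt fs f c v i j = gap (fs i (extendFalse v)) (f (extendFalse v)) j ≤ c + (1/suc j + 1/suc j)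

withinAt? : ∀ fs f c v i j → Dec (WithinAt fs f c v i j)
withinAt? fs f c v i j = _ ≤? _

semiUniform⇒securedBar : ∀ fs f c → 0ℚ < c → (∀ x → SemiUniformAt fs f x) → ∀ α → ∃[ n ] Secured (WithinAt fs f c) (init α n)
semiUniform⇒securedBar fs f c c>0 su α with su α c c>0
... | N , k , uniformNear = N ℕ.+ k , secured
  where
  secured : Secured (WithinAt fs f c) (init α (N ℕ.+ k))
  secured w i j N+k≤∣u∣ = dist<⇒dist≤ {c} {fs i y} {f y} (dist<-sym {c} {f y} {fs i y} (uniformNear y α≈y i N≤i)) j
    where
    u : List Bool
    u = init α (N ℕ.+ k)
    y : Cantor
    y = extendFalse (u ++ w)
    N≤i : N ℕ.≤ i
    N≤i = ℕ.≤-trans (ℕ.m≤m+n N k) (subst (ℕ._≤ i) (length-init α (N ℕ.+ k)) N+k≤∣u∣)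
    α≈y : close k α y
    α≈y j j<k = sym (trans (extendFalse-++ u w (subst (j ℕ.<_) (sym (length-init α _)) j<N+k)) (extendFalse-init α _ j<N+k))
      where
      j<N+k : j ℕ.< N ℕ.+ k
      j<N+k = ℕ.<-≤-trans j<k (ℕ.m≤n+m k N)

secured⇒nearOnPads : ∀ fs f c α {n i M} → Secured (WithinAt fs f c) (init α n) → n ℕ.≤ i → n ℕ.≤ M →
                     (dist≤ c) (fs i (pad M α)) (f (pad M α))
secured⇒nearOnPads fs f c α {n} {i} {M} secured n≤i n≤M j with init-prefix α n≤M
... | w , prefix = subst (λ v → WithinAt fs f c v i j) prefix
                     (secured w i j (subst (ℕ._≤ i) (sym (length-init α n)) n≤i))

fan⇒uniformSecuredBar : FAN-Π⁰₁ → ∀ fs f c → 0ℚ < c → (∀ x → SemiUniformAt fs f x) →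
                        ∃[ N ] ∀ α → ∃[ n ] (n ℕ.≤ N × Secured (WithinAt fs f c) (init α n))
fan⇒uniformSecuredBar fan fs f c c>0 su = N , secured-within-N
  where
  R? : ∀ v i j → Dec (WithinAt fs f c v i j)
  R? = withinAt? fs f c
  bar : IsBar (InB (securedSeq R?))
  bar α = let n , secured = semiUniform⇒securedBar fs f c c>0 su α in n , Secured⇒InB R? (init α n) secured
  uniformBar : IsUniformBar (InB (securedSeq R?))
  uniformBar = fan (securedSeq R?) (securedSeq-mono R?) bar
  N : ℕ
  N = proj₁ uniformBar
  secured-within-N : ∀ α → ∃[ n ] (n ℕ.≤ N × Secured (WithinAt fs f c) (init α n))
  secured-within-N α = let n , n≤N , inb = proj₂ uniformBar α in n , n≤N , InB⇒Secured R? (init α n) inb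

fan⇒star : FAN-Π⁰₁ → Star
fan⇒star fan fs f fs-ext f-ext fs-nd f-nd su ε ε>0 =
  let k , 4c<ε = archimedean-* 3 ε ε>0
      N , uniform = fan⇒uniformSecuredBar fan fs f (1/suc k) (1/suc-pos k) su
  in N , λ i N≤i α →
    let n , n≤N , secured = uniform α
    in NearOnApproximants.dist<-at-limit (fs i) f f-ext (fs-nd i) f-nd α
         (λ t → pad (N ℕ.+ t) α) (λ t → close-mono (ℕ.m≤n+m t N) (pad-close (N ℕ.+ t) α)) (1/suc k) (1/suc-pos k)
         (λ t → secured⇒nearOnPads fs f (1/suc k) α secured (ℕ.≤-trans n≤N N≤i) (ℕ.≤-trans n≤N (ℕ.m≤m+n N t)))
         ε 4c<ε

pointwiseContinuous⇒nonDiscontinuous : ∀ {g} → PointwiseContinuous g → NonDiscontinuous g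
pointwiseContinuous⇒nonDiscontinuous {g} g-pc (x , xs , δ , δ>0 , xs⟶x , far) =
  let k , near = g-pc x δ δ>0
      M , close-from-M = xs⟶x k
  in dist<⇒¬dist≥ {δ} {g (xs M)} {g x}
  (dist<-sym {δ} {g x} {g (xs M)} (near (xs M) λ i i<k → sym (close-from-M M ℕ.≤-refl i i<k))) (far M)

truncations : (Cantor → ℝ) → ℕ → Cantor → ℝ
truncations g n α = g (pad n α)

truncations-ext : ∀ g → Extensional g → ∀ n → Extensional (truncations g n)
truncations-ext g g-ext n α β α≡β = g-ext _ _ (pad-cong n α β λ j _ → α≡β j)

truncations-continuous : ∀ g → Extensional g → ∀ n → PointwiseContinuous (truncations g n)
truncations-continuous g g-ext n α ε ε>0 =
  n , λ β α≈β → ≃⇒dist< {ε} {g (pad n α)} {g (pad n β)} (g-ext _ _ (pad-cong n α β α≈β)) ε>0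

truncations-semiUniform : ∀ g → PointwiseContinuous g → ∀ x → SemiUniformAt (truncations g) g x
truncations-semiUniform g g-pc x ε ε>0 = m , m , λ y x≈y i m≤i →
  dist<-weaken {c + c} {ε} {g y} {truncations g i y}
    (dist<-trans {c} {c} {g y} {g x} {g (pad i y)} (dist<-sym {c} {g x} {g y} (near y x≈y))
      (near (pad i y) λ j j<m → trans (x≈y j j<m) (sym (pad-close i y j (ℕ.<-≤-trans j<m m≤i)))))
    (double≤ (proj₂ (archimedean-* 1 ε ε>0)))
  where
  k m : ℕ
  k = proj₁ (archimedean-* 1 ε ε>0)
  m = proj₁ (g-pc x (1/suc k) (1/suc-pos k))
  near : ∀ y → close m x y → (dist< (1/suc k)) (g x) (g y)
  near = proj₂ (g-pc x (1/suc k) (1/suc-pos k))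
  c : ℚ
  c = 1/suc k
  double≤ : c * (+ 2 / 1) < ε → c + c ≤ ε
  double≤ h = <⇒≤ (<-linear h (solve 2 (λ c ε → (c :+ c) :+ ε := ε :+ c :* con (+ 2 / 1)) refl c ε))

truncations-uniform⇒uniformlyContinuous : ∀ g → Extensional g → UniformConv (truncations g) g → UniformlyContinuous g
truncations-uniform⇒uniformlyContinuous g g-ext uniform ε ε>0 = N , λ α β α≈β →
  dist<-weaken {c + c + c} {ε} {g α} {g β}
    (dist<-trans {c + c} {c} {g α} {g (pad N β)} {g β}
      (dist<-trans {c} {c} {g α} {g (pad N α)} {g (pad N β)} (dist<-sym {c} {g (pad N α)} {g α} (near N ℕ.≤-refl α))
        (≃⇒dist< {c} {g (pad N α)} {g (pad N β)} (g-ext _ _ (pad-cong N α β α≈β)) (1/suc-pos k)))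
      (near N ℕ.≤-refl β))
    (triple≤ (proj₂ (archimedean-* 2 ε ε>0)))
  where
  k N : ℕ
  k = proj₁ (archimedean-* 2 ε ε>0)
  N = proj₁ (uniform (1/suc k) (1/suc-pos k))
  near : ∀ n → N ℕ.≤ n → ∀ α → (dist< (1/suc k)) (g (pad n α)) (g α)
  near = proj₂ (uniform (1/suc k) (1/suc-pos k))
  c : ℚ
  c = 1/suc k
  triple≤ : c * (+ 3 / 1) < ε → c + c + c ≤ ε
  triple≤ h = <⇒≤ (<-linear h (solve 2 (λ c ε → (c :+ c :+ c) :+ ε := ε :+ c :* con (+ 3 / 1)) refl c ε))

star⇒uct : Star → UCT
star⇒uct star g g-ext g-pc = truncations-uniform⇒uniformlyContinuous g g-ext
  (star (truncations g) g (truncations-ext g g-ext) g-ext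
    (λ n → pointwiseContinuous⇒nonDiscontinuous {truncations g n} (truncations-continuous g g-ext n))
    (pointwiseContinuous⇒nonDiscontinuous {g} g-pc)
    (truncations-semiUniform g g-pc))

proposition15 : (FAN-Π⁰₁ → Star) × (Star → UCT)
proposition15 = fan⇒star , star⇒uct
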